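{- Let $\lambda$ be a partition of $n$ and let $\omega,\gamma\in\mathfrak{S}_n$ both have cycle type $\lambda$. Then for each nonnegative integer $g$ there exists a bijection $\Delta:\mathcal{M}_g(\omega)\to\mathcal{M}_g(\gamma)$.
   Context: Permutations in $\mathfrak{S}_n$ are multiplied from left to right; a transposition is written $(a\,b)$ with $a<b$; $c(\omega)$ is the number of cycles of $\omega$. $\mathcal{M}_g(\omega)$ is the set of tuples of transpositions $((a_1\,b_1),\dots,(a_m\,b_m))$ with $(a_1\,b_1)\cdots(a_m\,b_m)=\omega$, $m=n-c(\omega)+2g$, and $b_1\le b_2\le\cdots\le b_m$ (genus $g$ monotone Hurwitz factorisations). -}

module Defs where

open import Data.Nat using (ℕ; zero; suc; _+_; _∸_; _*_; _≤_; _≥_)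
import Data.Nat as ℕ
open import Data.Bool using (Bool; true; false; _∧_; _∨_; not; T; if_then_else_)
open import Data.Fin using (Fin; toℕ; _<_)
open import Data.Fin.Properties using (_≟_)
open import Data.Fin.Permutation using (Permutation′; _⟨$⟩ʳ_)
open import Data.List using (List; []; _∷_; filter; length; allFin)
open import Data.Nat.ListAction using (sum)
open import Data.Bool.ListAction using (all; any)
import Data.List as L
open import Data.List.Relation.Unary.All using (All)
open import Data.List.Relation.Unary.Linked using (Linked)
open import Data.Vec using (Vec)
import Data.Vec as V
open import Data.Product using (Σ; _×_; _,_; proj₁; proj₂)
open import Relation.Nullary.Decidable using (⌊_⌋)

IsPartition : ℕ → List ℕ → Set
IsPartition n λ′ = All (λ p → 1 ≤ p) λ′ × Linked _≥_ λ′ × sum λ′ ≡′ n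
  where open import Relation.Binary.PropositionalEquality using () renaming (_≡_ to _≡′_)

allF : ∀ {n} → (Fin n → Bool) → Bool
allF {n} p = all p (allFin n)

anyF : ∀ {n} → (Fin n → Bool) → Bool
anyF {n} p = any p (allFin n)

countF : ∀ {n} → (Fin n → Bool) → ℕ
countF {n} p = L.foldr (λ i acc → if p i then suc acc else acc) 0 (allFin n)

_==_ : ∀ {n} → Fin n → Fin n → Bool
i == j = ⌊ i ≟ j ⌋

iter : ∀ {n} → Permutation′ n → ℕ → Fin n → Fin n
iter ω zero    i = i
iter ω (suc t) i = ω ⟨$⟩ʳ (iter ω t i)

inCycle : ∀ {n} → Permutation′ n → Fin n → Fin n → Bool
inCycle {n} ω i j = any (λ t → iter ω t i == j) (L.upTo n)

-- i is the least element of its cycle (one representative per cycle)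
isCycleMin : ∀ {n} → Permutation′ n → Fin n → Bool
isCycleMin ω i = allF (λ j → not (inCycle ω i j) ∨ ⌊ toℕ i ℕ.≤? toℕ j ⌋)

cycleLength : ∀ {n} → Permutation′ n → Fin n → ℕ
cycleLength ω i = countF (inCycle ω i)

numCycles : ∀ {n} → Permutation′ n → ℕ
numCycles ω = countF (isCycleMin ω)

numCyclesOfLength : ∀ {n} → Permutation′ n → ℕ → ℕ
numCyclesOfLength ω k = countF (λ i → isCycleMin ω i ∧ ⌊ cycleLength ω i ℕ.≟ k ⌋)

multiplicity : ℕ → List ℕ → ℕ
multiplicity k λ′ = length (filter (λ p → p ℕ.≟ k) λ′)

HasCycleType : ∀ {n} → Permutation′ n → List ℕ → Set
HasCycleType ω λ′ = ∀ k → numCyclesOfLength ω k ≡′ multiplicity k λ′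
  where open import Relation.Binary.PropositionalEquality using () renaming (_≡_ to _≡′_)

Transposition : ℕ → Set
Transposition n = Σ (Fin n × Fin n) (λ ab → T ⌊ toℕ (proj₁ ab) ℕ.<? toℕ (proj₂ ab) ⌋)

swap : ∀ {n} → Fin n → Fin n → Fin n → Fin n
swap a b x = if x == a then b else (if x == b then a else x)

-- product τ₁ τ₂ ⋯ τₘ, multiplied left to right: x ↦ τₘ(⋯ τ₂(τ₁ x))
applyProduct : ∀ {n m} → Vec (Transposition n) m → Fin n → Fin n
applyProduct ts x = V.foldl (λ _ → _) (λ y t → swap (proj₁ (proj₁ t)) (proj₂ (proj₁ t)) y) x ts

productIs : ∀ {n m} → Vec (Transposition n) m → Permutation′ n → Bool
productIs ts ω = allF (λ x → applyProduct ts x == (ω ⟨$⟩ʳ x))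

monotone : ∀ {n} → List (Transposition n) → Bool
monotone []            = true
monotone (t ∷ [])      = true
monotone (t ∷ s ∷ ts)  = ⌊ toℕ (proj₂ (proj₁ t)) ℕ.≤? toℕ (proj₂ (proj₁ s)) ⌋ ∧ monotone (s ∷ ts)

numFactors : ∀ {n} → Permutation′ n → ℕ → ℕ
numFactors {n} ω g = n ∸ numCycles ω + 2 * g

M : ∀ {n} → ℕ → Permutation′ n → Set
M {n} g ω = Σ (Vec (Transposition n) (numFactors ω g))
              (λ ts → T (productIs ts ω ∧ monotone (V.toList ts)))

{-# OPTIONS --safe #-}
module Submission where

open import Defs
open import Data.Bool using (Bool; true; false; if_then_else_; T; _∧_; _∨_; not)
open import Data.Bool.ListAction using (all; any)
open import Data.Bool.Properties using (T-≡; T-irrelevant; ∧-identityʳ)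
open import Data.Empty using (⊥; ⊥-elim)
open import Data.Fin using (Fin; toℕ; fromℕ<) renaming (zero to fzero; suc to fsuc)
open import Data.Fin.Permutation using (Permutation′; _⟨$⟩ʳ_; _⟨$⟩ˡ_; transpose; inverseʳ; inverseˡ)
import Data.Fin.Permutation.Components as Components
open import Data.Fin.Permutation.Transposition.List using (eval; decompose; eval-decompose)
open import Data.Fin.Properties
  using (_≟_; +↔⊎; injective⇒≤; suc-injective; toℕ-injective; toℕ-fromℕ<; toℕ<n; pigeonhole)
open import Data.List using (List; []; _∷_; allFin; map; foldr; tabulate; upTo)
open import Data.List.Membership.Propositional using (_∈_)
open import Data.List.Membership.Propositional.Properties using (∈-allFin; ∈-upTo⁺)
open import Data.List.Properties using (foldr-map; map-tabulate)
open import Data.List.Relation.Unary.Any using (here; there)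
open import Data.Maybe using (Maybe; just; nothing; fromMaybe)
import Data.Maybe as Maybe
open import Data.Maybe.Properties using (just-injective)
open import Data.Nat using (ℕ; zero; suc; _+_; _*_; _∸_; _≤_; _<_; z≤n; s≤s; z<s)
import Data.Nat as ℕ
import Data.Nat.Properties as ℕP
open import Algebra.Properties.CommutativeMonoid.Sum ℕP.+-0-commutativeMonoid
  using (sum; sum-cong-≗; sum-replicate-zero; ∑-permute; ∑-distrib-+; ∑-comm)
open import Algebra.Properties.CommutativeSemigroup ℕP.+-commutativeSemigroup using (interchange; x∙yz≈yx∙z)
open import Data.Nat.DivMod using (_%_; _/_; m≡m%n+[m/n]*n; m%n<n)
open import Data.Product using (Σ; _×_; _,_; proj₁; proj₂)
open import Data.Product.Function.Dependent.Propositional using (Σ-↔)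
open import Data.Product.Function.NonDependent.Propositional using (_×-↔_)
open import Data.Sum using (_⊎_; inj₁; inj₂)
open import Data.Sum.Function.Propositional using (_⊎-↔_)
open import Data.Unit using (tt)
open import Data.Vec using (Vec; []; _∷_; toList)
open import Function using (_∘_; case_of_; _↔_; _⤖_; mk↔ₛ′; Inverse; Injection; Equivalence)
open import Function.Properties.Inverse using (↔-trans; ↔-sym; ↔-refl; ↔⇒↣; ↔⇒⤖)
open import Relation.Binary using (tri<; tri≈; tri>)
open import Relation.Binary.PropositionalEquality
  using (_≡_; _≢_; refl; sym; trans; cong; cong₂; subst; _≗_; module ≡-Reasoning)
open import Relation.Nullary using (Dec; yes; no; ¬_)
open import Relation.Nullary.Decidable using (⌊_⌋)

-- Let J_b = Σ_{a<b} (a b) be the Jucys–Murphy elements of ℕ[𝔖ₙ]. Peeling off the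
-- factors of a monotone factorisation level by level shows that the number of monotone
-- factorisations of p into m transpositions is the coefficient of p in the complete homogeneous
-- symmetric polynomial h_m(J_1, …, J_n). That element is central: an adjacent transposition
-- s = (x x+1) commutes with every J_c for c ∉ {x, x+1}, and satisfies s J_x s = J_{x+1} − s, so
-- it commutes with J_x + J_{x+1} and J_x J_{x+1}, hence with h_r(J_x, J_{x+1}), hence with h_m.
-- Central elements have coefficients constant on conjugacy classes. Permutations of equal cycle
-- type are conjugate and have the same number of cycles, so |𝓜_g(ω)| = |𝓜_g(γ)|, and two finite
-- sets of equal cardinality are in bijection.

⌊⌋-true : ∀ {P : Set} (d : Dec P) → P → ⌊ d ⌋ ≡ true
⌊⌋-true (yes _) _ = refl
⌊⌋-true (no ¬p) p = ⊥-elim (¬p p)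

⌊⌋-false : ∀ {P : Set} (d : Dec P) → ¬ P → ⌊ d ⌋ ≡ false
⌊⌋-false (yes p) ¬p = ⊥-elim (¬p p)
⌊⌋-false (no _) _ = refl

⌊⌋-sound : ∀ {P : Set} (d : Dec P) → ⌊ d ⌋ ≡ true → P
⌊⌋-sound (yes p) _ = p

T→≡ : ∀ {b} → T b → b ≡ true
T→≡ = Equivalence.to T-≡

≡→T : ∀ {b} → b ≡ true → T b
≡→T = Equivalence.from T-≡

∧-elim : ∀ {a b} → a ∧ b ≡ true → a ≡ true × b ≡ true
∧-elim {true} {true} _ = refl , refl

∧-intro : ∀ {a b} → a ≡ true → b ≡ true → a ∧ b ≡ true
∧-intro refl refl = refl

true⇔true⇒≡ : ∀ {a b : Bool} → (a ≡ true → b ≡ true) → (b ≡ true → a ≡ true) → a ≡ b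
true⇔true⇒≡ {true} {true} _ _ = refl
true⇔true⇒≡ {true} {false} f _ = sym (f refl)
true⇔true⇒≡ {false} {true} _ g = g refl
true⇔true⇒≡ {false} {false} _ _ = refl

Σ-T-≡ : ∀ {A : Set} {P : A → Bool} {a a′ : A} {p : T (P a)} {p′ : T (P a′)} →
        a ≡ a′ → _≡_ {A = Σ A (T ∘ P)} (a , p) (a′ , p′)
Σ-T-≡ {P = P} {a} refl = cong (a ,_) (T-irrelevant _ _)

Σ-T-cong : ∀ {A : Set} {P Q : A → Bool} → (∀ x → P x ≡ Q x) → Σ A (T ∘ P) ↔ Σ A (T ∘ Q)
Σ-T-cong P≗Q = mk↔ₛ′ (λ (a , p) → a , subst T (P≗Q a) p) (λ (a , q) → a , subst T (sym (P≗Q a)) q)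
                     (λ _ → Σ-T-≡ refl) (λ _ → Σ-T-≡ refl)

module _ {n : ℕ} where

  ==-refl : (a : Fin n) → a == a ≡ true
  ==-refl a = ⌊⌋-true (a ≟ a) refl

  ≡⇒== : {a b : Fin n} → a ≡ b → a == b ≡ true
  ≡⇒== {a} refl = ==-refl a

  ==⇒≡ : {a b : Fin n} → a == b ≡ true → a ≡ b
  ==⇒≡ {a} {b} = ⌊⌋-sound (a ≟ b)

  ≢⇒==-false : {a b : Fin n} → a ≢ b → a == b ≡ false
  ≢⇒==-false {a} {b} = ⌊⌋-false (a ≟ b)

  ==-sym : (a b : Fin n) → a == b ≡ b == a
  ==-sym a b = true⇔true⇒≡ (≡⇒== ∘ sym ∘ ==⇒≡) (≡⇒== ∘ sym ∘ ==⇒≡)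

all-sound : ∀ {A : Set} (P : A → Bool) (xs : List A) → all P xs ≡ true → ∀ {x} → x ∈ xs → P x ≡ true
all-sound P (y ∷ ys) e (here refl) = proj₁ (∧-elim {P y} e)
all-sound P (y ∷ ys) e (there x∈ys) = all-sound P ys (proj₂ (∧-elim {P y} e)) x∈ys

all-complete : ∀ {A : Set} (P : A → Bool) (xs : List A) → (∀ x → P x ≡ true) → all P xs ≡ true
all-complete P [] _ = refl
all-complete P (y ∷ ys) h rewrite h y = all-complete P ys h

all-cong : ∀ {A : Set} {P Q : A → Bool} (xs : List A) → (∀ x → P x ≡ Q x) → all P xs ≡ all Q xs
all-cong [] _ = refl
all-cong (y ∷ ys) h = cong₂ _∧_ (h y) (all-cong ys h)

any-sound : ∀ {A : Set} (P : A → Bool) (xs : List A) → any P xs ≡ true → Σ A (λ x → P x ≡ true)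
any-sound P (x ∷ xs) e with P x in eq
... | true = x , eq
... | false = any-sound P xs e

any-complete : ∀ {A : Set} (P : A → Bool) (xs : List A) {x : A} → x ∈ xs → P x ≡ true → any P xs ≡ true
any-complete P (y ∷ ys) (here refl) e rewrite e = refl
any-complete P (y ∷ ys) (there x∈ys) e with P y
... | true = refl
... | false = any-complete P ys x∈ys e

allF-sound : ∀ {n} (P : Fin n → Bool) → allF P ≡ true → ∀ x → P x ≡ true
allF-sound {n} P e x = all-sound P (allFin n) e (∈-allFin x)

allF-complete : ∀ {n} (P : Fin n → Bool) → (∀ x → P x ≡ true) → allF P ≡ true
allF-complete {n} P = all-complete P (allFin n)

module _ {n : ℕ} where

  swap-≡ˡ : {a b z : Fin n} → z ≡ a → swap a b z ≡ b
  swap-≡ˡ {a} refl rewrite ==-refl a = refl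

  swap-≡ʳ : {a b z : Fin n} → z ≢ a → z ≡ b → swap a b z ≡ a
  swap-≡ʳ {b = b} z≢a refl rewrite ≢⇒==-false z≢a | ==-refl b = refl

  swap-≢ : {a b z : Fin n} → z ≢ a → z ≢ b → swap a b z ≡ z
  swap-≢ z≢a z≢b rewrite ≢⇒==-false z≢a | ≢⇒==-false z≢b = refl

  swap-left : (a b : Fin n) → swap a b a ≡ b
  swap-left a b = swap-≡ˡ {a} {b} refl

  swap-right : (a b : Fin n) → swap a b b ≡ a
  swap-right a b = case b ≟ a of λ where
    (yes b≡a) → trans (swap-≡ˡ b≡a) b≡a
    (no b≢a) → swap-≡ʳ b≢a refl

  swap-involutive : (a b z : Fin n) → swap a b (swap a b z) ≡ z
  swap-involutive a b z = case ((z ≟ a) , (z ≟ b)) of λ where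
    (yes z≡a , _) → trans (cong (swap a b) (swap-≡ˡ z≡a)) (trans (swap-right a b) (sym z≡a))
    (no z≢a , yes z≡b) → trans (cong (swap a b) (swap-≡ʳ z≢a z≡b)) (trans (swap-left a b) (sym z≡b))
    (no z≢a , no z≢b) → trans (cong (swap a b) (swap-≢ z≢a z≢b)) (swap-≢ z≢a z≢b)

  swap-sym : (a b z : Fin n) → swap a b z ≡ swap b a z
  swap-sym a b z = case ((z ≟ a) , (z ≟ b)) of λ where
    (yes z≡a , yes z≡b) → trans (swap-≡ˡ z≡a) (trans (sym z≡b) (trans z≡a (sym (swap-≡ˡ z≡b))))
    (yes z≡a , no z≢b) → trans (swap-≡ˡ z≡a) (sym (swap-≡ʳ z≢b z≡a))
    (no z≢a , yes z≡b) → trans (swap-≡ʳ z≢a z≡b) (sym (swap-≡ˡ z≡b))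
    (no z≢a , no z≢b) → trans (swap-≢ z≢a z≢b) (sym (swap-≢ z≢b z≢a))

  swap-self : (a z : Fin n) → swap a a z ≡ z
  swap-self a z = case z ≟ a of λ where
    (yes z≡a) → trans (swap-≡ˡ z≡a) (sym z≡a)
    (no z≢a) → swap-≢ z≢a z≢a

  swap-conjugate : (σ σ⁻¹ : Fin n → Fin n) → (∀ z → σ (σ⁻¹ z) ≡ z) → (∀ z → σ⁻¹ (σ z) ≡ z) →
                   (a c z : Fin n) → σ (swap a c (σ⁻¹ z)) ≡ swap (σ a) (σ c) z
  swap-conjugate σ σ⁻¹ σσ⁻¹ σ⁻¹σ a c z = case ((z ≟ σ a) , (z ≟ σ c)) of λ where
      (yes z≡σa , _) → trans (cong σ (trans (cong (swap a c) (moved z≡σa)) (swap-left a c))) (sym (swap-≡ˡ z≡σa))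
      (no z≢σa , yes z≡σc) →
        trans (cong σ (trans (cong (swap a c) (moved z≡σc)) (swap-right a c))) (sym (swap-≡ʳ z≢σa z≡σc))
      (no z≢σa , no z≢σc) →
        trans (cong σ (swap-≢ (z≢σa ∘ unmoved) (z≢σc ∘ unmoved))) (trans (σσ⁻¹ z) (sym (swap-≢ z≢σa z≢σc)))
    where
    moved : ∀ {w} → z ≡ σ w → σ⁻¹ z ≡ w
    moved e = trans (cong σ⁻¹ e) (σ⁻¹σ _)
    unmoved : ∀ {w} → σ⁻¹ z ≡ w → z ≡ σ w
    unmoved e = trans (sym (σσ⁻¹ z)) (cong σ e)

  swap-swap : (x y a c z : Fin n) → swap x y (swap a c z) ≡ swap (swap x y a) (swap x y c) (swap x y z)
  swap-swap x y a c z =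
    trans (cong (swap x y ∘ swap a c) (sym (swap-involutive x y z)))
          (swap-conjugate (swap x y) (swap x y) (swap-involutive x y) (swap-involutive x y) a c (swap x y z))

  transpose≗swap : (a b : Fin n) → Components.transpose a b ≗ swap a b
  transpose≗swap a b z with z ≟ a
  ... | yes _ = refl
  ... | no _ with z ≟ b
  ...   | yes _ = refl
  ...   | no _ = refl

when : Bool → ℕ → ℕ
when b v = if b then v else 0

when-cong : ∀ b {u v} → (b ≡ true → u ≡ v) → when b u ≡ when b v
when-cong true u≡v = u≡v refl
when-cong false _ = refl

when-+ : ∀ b u v → when b (u + v) ≡ when b u + when b v
when-+ true u v = refl
when-+ false u v = refl

when-comm : ∀ b c v → when b (when c v) ≡ when c (when b v)
when-comm true c v = refl
when-comm false true v = refl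
when-comm false false v = refl

sum-zero : ∀ {n} (f : Fin n → ℕ) → (∀ a → f a ≡ 0) → sum f ≡ 0
sum-zero {n} f f≗0 = trans (sum-cong-≗ f≗0) (sum-replicate-zero n)

when-sum : ∀ {n} b (f : Fin n → ℕ) → when b (sum f) ≡ sum (λ a → when b (f a))
when-sum true f = refl
when-sum {n} false f = sym (sum-zero {n} _ (λ _ → refl))

sum-single : ∀ {n} (f : Fin n → ℕ) (x : Fin n) → (∀ a → a ≢ x → f a ≡ 0) → sum f ≡ f x
sum-single {suc n} f fzero f≗0 =
  trans (cong (f fzero +_) (sum-zero (f ∘ fsuc) (λ a → f≗0 (fsuc a) (λ ())))) (ℕP.+-identityʳ _)
sum-single {suc n} f (fsuc x) f≗0 =
  cong₂ _+_ (f≗0 fzero (λ ())) (sum-single (f ∘ fsuc) x (λ a a≢x → f≗0 (fsuc a) (a≢x ∘ suc-injective)))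

module _ {n : ℕ} where

  sum-delta : (x : Fin n) (f : Fin n → ℕ) → sum (λ a → when (a == x) (f a)) ≡ f x
  sum-delta x f =
    trans (sum-single _ x (λ a a≢x → cong (λ b → when b (f a)) (≢⇒==-false a≢x)))
          (cong (λ b → when b (f x)) (==-refl x))

  sum-swap : (x y : Fin n) (f : Fin n → ℕ) → sum f ≡ sum (f ∘ swap x y)
  sum-swap x y f = trans (∑-permute f (transpose x y)) (sum-cong-≗ (cong f ∘ transpose≗swap x y))

T↔Fin : ∀ b → T b ↔ Fin (when b 1)
T↔Fin true = mk↔ₛ′ (λ _ → fzero) (λ _ → tt) (λ { fzero → refl ; (fsuc ()) }) (λ _ → refl)
T↔Fin false = mk↔ₛ′ (λ ()) (λ ()) (λ ()) (λ ())

Fin-when : ∀ b v → Fin (when b v) ↔ (T b × Fin v)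
Fin-when true v = mk↔ₛ′ (tt ,_) proj₂ (λ _ → refl) (λ _ → refl)
Fin-when false v = mk↔ₛ′ (λ ()) (λ ()) (λ ()) (λ ())

Σ-Fin-suc : ∀ {n} (B : Fin (suc n) → Set) → (B fzero ⊎ Σ (Fin n) (B ∘ fsuc)) ↔ Σ (Fin (suc n)) B
Σ-Fin-suc B = mk↔ₛ′ to from to∘from from∘to
  where
  to : B fzero ⊎ Σ _ (B ∘ fsuc) → Σ _ B
  to (inj₁ b) = fzero , b
  to (inj₂ (a , b)) = fsuc a , b
  from : Σ _ B → B fzero ⊎ Σ _ (B ∘ fsuc)
  from (fzero , b) = inj₁ b
  from (fsuc a , b) = inj₂ (a , b)
  to∘from : ∀ y → to (from y) ≡ y
  to∘from (fzero , b) = refl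
  to∘from (fsuc a , b) = refl
  from∘to : ∀ x → from (to x) ≡ x
  from∘to (inj₁ b) = refl
  from∘to (inj₂ (a , b)) = refl

Fin-sum : ∀ {n} (f : Fin n → ℕ) → Fin (sum f) ↔ Σ (Fin n) (Fin ∘ f)
Fin-sum {zero} f = mk↔ₛ′ (λ ()) (λ ()) (λ ()) (λ ())
Fin-sum {suc n} f = ↔-trans +↔⊎ (↔-trans (↔-refl ⊎-↔ Fin-sum (f ∘ fsuc)) (Σ-Fin-suc (Fin ∘ f)))

countF-suc : ∀ {n} (P : Fin (suc n) → Bool) → countF P ≡ when (P fzero) 1 + countF (P ∘ fsuc)
countF-suc {n} P = trans (cong (step fzero) countF-tail) (step-when (P fzero) _)
  where
  step : Fin (suc n) → ℕ → ℕ
  step i acc = if P i then suc acc else acc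
  countF-tail : foldr step 0 (tabulate fsuc) ≡ countF (P ∘ fsuc)
  countF-tail = trans (cong (foldr step 0) (sym (map-tabulate (λ i → i) fsuc))) (foldr-map step fsuc 0 (allFin n))
  step-when : ∀ b c → (if b then suc c else c) ≡ when b 1 + c
  step-when true c = refl
  step-when false c = refl

count↔ : ∀ {n} (P : Fin n → Bool) → Σ (Fin n) (T ∘ P) ↔ Fin (countF P)
count↔ {zero} P = mk↔ₛ′ (λ ()) (λ ()) (λ ()) (λ ())
count↔ {suc n} P =
  subst (λ c → Σ (Fin (suc n)) (T ∘ P) ↔ Fin c) (sym (countF-suc P))
    (↔-trans (↔-sym (Σ-Fin-suc (T ∘ P))) (↔-trans (T↔Fin (P fzero) ⊎-↔ count↔ (P ∘ fsuc)) (↔-sym +↔⊎)))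

Fin-↔-injective : ∀ {a b} → Fin a ↔ Fin b → a ≡ b
Fin-↔-injective a↔b = ℕP.≤-antisym (injection⇒≤ a↔b) (injection⇒≤ (↔-sym a↔b))
  where
  injection⇒≤ : ∀ {a b} → Fin a ↔ Fin b → a ≤ b
  injection⇒≤ a↔b = injective⇒≤ (Injection.injective (↔⇒↣ a↔b))

-- Jucys–Murphy elements

module JucysMurphy (n : ℕ) where

  -- An element of the group semiring ℕ[𝔖ₙ], given by its coefficients (values at non-bijective maps
  -- play no role). Composing maps as functions, J c f = f · J_c with J_c = Σ_{a<c} (a c), and
  -- hJ L m is the complete homogeneous symmetric polynomial h_m(J_b : b ∈ L).
  ℕ[𝔖] : Set
  ℕ[𝔖] = (Fin n → Fin n) → ℕ

  Respects-≗ : ℕ[𝔖] → Set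
  Respects-≗ f = ∀ {p q} → p ≗ q → f p ≡ f q

  _<ᵇ_ : Fin n → Fin n → Bool
  a <ᵇ c = ⌊ toℕ a ℕ.<? toℕ c ⌋

  _⊕_ : ℕ[𝔖] → ℕ[𝔖] → ℕ[𝔖]
  (f ⊕ g) p = f p + g p

  𝟘 : ℕ[𝔖]
  𝟘 _ = 0

  𝟙 : ℕ[𝔖]
  𝟙 p = when (allF (λ z → p z == z)) 1

  J : Fin n → ℕ[𝔖] → ℕ[𝔖]
  J c f p = sum (λ a → when (a <ᵇ c) (f (p ∘ swap a c)))

  hJ : List (Fin n) → ℕ → ℕ[𝔖]
  hJ _ zero = 𝟙
  hJ [] (suc m) = 𝟘
  hJ (b ∷ L) (suc m) = hJ L (suc m) ⊕ J b (hJ (b ∷ L) m)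

  -- f · (x y) and (x y) · f, in the same convention.
  precompose : Fin n → Fin n → ℕ[𝔖] → ℕ[𝔖]
  precompose x y f p = f (p ∘ swap x y)

  postcompose : Fin n → Fin n → ℕ[𝔖] → ℕ[𝔖]
  postcompose x y f p = f (swap x y ∘ p)

  CommutesWith : Fin n → Fin n → ℕ[𝔖] → Set
  CommutesWith x y f = precompose x y f ≗ postcompose x y f

  <ᵇ⇒< : ∀ {a c} → a <ᵇ c ≡ true → toℕ a < toℕ c
  <ᵇ⇒< {a} {c} = ⌊⌋-sound (toℕ a ℕ.<? toℕ c)

  <⇒<ᵇ : ∀ {a c} → toℕ a < toℕ c → a <ᵇ c ≡ true
  <⇒<ᵇ {a} {c} = ⌊⌋-true (toℕ a ℕ.<? toℕ c)

  <ᵇ⇒≢ : ∀ {a c} → a <ᵇ c ≡ true → a ≢ c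
  <ᵇ⇒≢ a<c refl = ℕP.<-irrefl refl (<ᵇ⇒< a<c)

  <ᵇ-swap : ∀ x y c w → x <ᵇ c ≡ y <ᵇ c → swap x y w <ᵇ c ≡ w <ᵇ c
  <ᵇ-swap x y c w x~y = case ((w ≟ x) , (w ≟ y)) of λ where
      (yes refl , _) → trans (cong (_<ᵇ c) (swap-left w y)) (sym x~y)
      (no w≢x , yes refl) → trans (cong (_<ᵇ c) (swap-≡ʳ w≢x refl)) x~y
      (no w≢x , no w≢y) → cong (_<ᵇ c) (swap-≢ w≢x w≢y)

  𝟙-respects : Respects-≗ 𝟙
  𝟙-respects p≗q = cong (λ b → when b 1) (all-cong (allFin n) (λ z → cong (_== z) (p≗q z)))

  ⊕-respects : ∀ {f g} → Respects-≗ f → Respects-≗ g → Respects-≗ (f ⊕ g)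
  ⊕-respects rf rg p≗q = cong₂ _+_ (rf p≗q) (rg p≗q)

  J-respects : ∀ c {f} → Respects-≗ f → Respects-≗ (J c f)
  J-respects c rf p≗q = sum-cong-≗ (λ a → cong (when (a <ᵇ c)) (rf (p≗q ∘ swap a c)))

  hJ-respects : ∀ L m → Respects-≗ (hJ L m)
  hJ-respects _ zero = 𝟙-respects
  hJ-respects [] (suc m) _ = refl
  hJ-respects (b ∷ L) (suc m) = ⊕-respects (hJ-respects L (suc m)) (J-respects b (hJ-respects (b ∷ L) m))

  precompose-respects : ∀ x y {f} → Respects-≗ f → Respects-≗ (precompose x y f)
  precompose-respects x y rf p≗q = rf (p≗q ∘ swap x y)

  J-cong : ∀ c {f g} → f ≗ g → J c f ≗ J c g
  J-cong c f≗g p = sum-cong-≗ (λ a → cong (when (a <ᵇ c)) (f≗g _))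

  J-⊕ : ∀ c f g → J c (f ⊕ g) ≗ (J c f ⊕ J c g)
  J-⊕ c f g p = trans (sum-cong-≗ (λ a → when-+ (a <ᵇ c) _ _))
                      (∑-distrib-+ (λ a → when (a <ᵇ c) (f (p ∘ swap a c))) (λ a → when (a <ᵇ c) (g (p ∘ swap a c))))

  𝟙-commutes : ∀ x y → CommutesWith x y 𝟙
  𝟙-commutes x y p = cong (λ b → when b 1)
    (true⇔true⇒≡ (is-identity (s ∘ p) ∘ left⇒right ∘ identity-of (p ∘ s))
                  (is-identity (p ∘ s) ∘ right⇒left ∘ identity-of (s ∘ p)))
    where
    s = swap x y
    identity-of : ∀ q → allF (λ z → q z == z) ≡ true → ∀ z → q z ≡ z
    identity-of q q≡id z = ==⇒≡ (allF-sound _ q≡id z)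
    is-identity : ∀ q → (∀ z → q z ≡ z) → allF (λ z → q z == z) ≡ true
    is-identity q q≗id = allF-complete _ (≡⇒== ∘ q≗id)
    left⇒right : (∀ z → p (s z) ≡ z) → ∀ z → s (p z) ≡ z
    left⇒right ps≗id z =
      trans (cong (s ∘ p) (sym (swap-involutive x y z))) (trans (cong s (ps≗id (s z))) (swap-involutive x y z))
    right⇒left : (∀ z → s (p z) ≡ z) → ∀ z → p (s z) ≡ z
    right⇒left sp≗id z =
      trans (sym (swap-involutive x y (p (s z)))) (trans (cong s (sp≗id (s z))) (swap-involutive x y z))

  ⊕-commutes : ∀ x y f g → CommutesWith x y f → CommutesWith x y g → CommutesWith x y (f ⊕ g)
  ⊕-commutes x y f g cf cg p = cong₂ _+_ (cf p) (cg p)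

  commutes-cong : ∀ x y {f g} → f ≗ g → CommutesWith x y f → CommutesWith x y g
  commutes-cong x y f≗g cf p = trans (sym (f≗g _)) (trans (cf p) (f≗g _))

  precompose-J : ∀ x y c f → Respects-≗ f → swap x y c ≡ c → x <ᵇ c ≡ y <ᵇ c →
                 precompose x y (J c f) ≗ J c (precompose x y f)
  precompose-J x y c f rf sc≡c x~y p =
    trans (sum-cong-≗ (λ a → cong₂ when (sym (<ᵇ-swap x y c a x~y)) (rf (cong p ∘ conjugated a))))
          (sym (sum-swap x y _))
    where
    conjugated : ∀ a z → swap x y (swap a c z) ≡ swap (swap x y a) c (swap x y z)
    conjugated a z = trans (swap-swap x y a c z) (cong (λ u → swap (swap x y a) u (swap x y z)) sc≡c)

  when-<ᵇ-suc : ∀ {x y} a v → toℕ y ≡ suc (toℕ x) → when (a <ᵇ y) v ≡ when (a <ᵇ x) v + when (a == x) v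
  when-<ᵇ-suc {x} {y} a v y≡1+x with a ≟ x
  ... | yes refl rewrite <⇒<ᵇ {a} {y} (ℕP.≤-reflexive (sym y≡1+x))
                       | ⌊⌋-false (toℕ a ℕ.<? toℕ a) (ℕP.<-irrefl refl) = refl
  ... | no a≢x = trans (cong (λ b → when b v) a<y≡a<x) (sym (ℕP.+-identityʳ _))
    where
    a<y≡a<x : a <ᵇ y ≡ a <ᵇ x
    a<y≡a<x = true⇔true⇒≡
      (λ a<y → <⇒<ᵇ (ℕP.≤∧≢⇒< (ℕP.≤-pred (subst (toℕ a <_) y≡1+x (<ᵇ⇒< a<y)))
                                (a≢x ∘ toℕ-injective)))
      (λ a<x → <⇒<ᵇ (subst (toℕ a <_) (sym y≡1+x) (ℕP.m<n⇒m<1+n (<ᵇ⇒< a<x))))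

  sum-below-suc : ∀ x y → toℕ y ≡ suc (toℕ x) → ∀ (g : Fin n → ℕ) →
                  sum (λ a → when (a <ᵇ y) (g a)) ≡ sum (λ a → when (a <ᵇ x) (g a)) + g x
  sum-below-suc x y y≡1+x g =
    trans (sum-cong-≗ (λ a → when-<ᵇ-suc a (g a) y≡1+x))
          (trans (∑-distrib-+ (λ a → when (a <ᵇ x) (g a)) (λ a → when (a == x) (g a)))
                 (cong (sum (λ a → when (a <ᵇ x) (g a)) +_) (sum-delta x g)))

  swap-fixes-below : ∀ {x y a} → toℕ y ≡ suc (toℕ x) → a <ᵇ x ≡ true → swap x y a ≡ a
  swap-fixes-below {x} {y} {a} y≡1+x a<x = swap-≢ (<ᵇ⇒≢ a<x) a≢y
    where
    a≢y : a ≢ y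
    a≢y refl = ℕP.<-asym (<ᵇ⇒< a<x) (ℕP.≤-reflexive (sym y≡1+x))

  module _ (x y : Fin n) (y≡1+x : toℕ y ≡ suc (toℕ x)) (f : ℕ[𝔖]) (rf : Respects-≗ f) where

    private
      s = swap x y

    precompose-J-lower : (precompose x y (J x f) ⊕ f) ≗ J y (precompose x y f)
    precompose-J-lower p =
      sym (trans (sum-below-suc x y y≡1+x _) (cong₂ _+_ (sum-cong-≗ conjugate) (rf (cong p ∘ swap-involutive x y))))
      where
      conjugate : ∀ a → when (a <ᵇ x) (f (p ∘ swap a y ∘ s)) ≡ when (a <ᵇ x) (f (p ∘ s ∘ swap a x))
      conjugate a = when-cong (a <ᵇ x) λ a<x → rf λ z → cong p (sym
        (trans (swap-swap x y a x z) (cong₂ (λ u v → swap u v (s z)) (swap-fixes-below y≡1+x a<x) (swap-left x y))))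

    precompose-J-upper : precompose x y (J y f) ≗ (J x (precompose x y f) ⊕ f)
    precompose-J-upper p =
      trans (sum-below-suc x y y≡1+x _) (cong₂ _+_ (sum-cong-≗ conjugate) (rf (cong p ∘ swap-involutive x y)))
      where
      conjugate : ∀ a → when (a <ᵇ x) (f (p ∘ s ∘ swap a y)) ≡ when (a <ᵇ x) (f (p ∘ swap a x ∘ s))
      conjugate a = when-cong (a <ᵇ x) λ a<x → rf λ z → cong p
        (trans (swap-swap x y a y z) (cong₂ (λ u v → swap u v (s z)) (swap-fixes-below y≡1+x a<x) (swap-right x y)))

  J-comm : ∀ x y f → x <ᵇ y ≡ true → Respects-≗ f → J x (J y f) ≗ J y (J x f)
  J-comm x y f x<y rf p = trans (sum-cong-≗ reindex) (sym exchange)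
    where
    F : Fin n → Fin n → ℕ
    F c a = f (p ∘ swap c y ∘ swap a x)
    exchange : J y (J x f) p ≡ sum (λ a → when (a <ᵇ x) (sum (λ c → when (c <ᵇ y) (F c a))))
    exchange =
      trans (sum-cong-≗ (λ c → when-sum (c <ᵇ y) (λ a → when (a <ᵇ x) (F c a))))
      (trans (∑-comm (λ c a → when (c <ᵇ y) (when (a <ᵇ x) (F c a))))
             (sum-cong-≗ (λ a → trans (sum-cong-≗ (λ c → when-comm (c <ᵇ y) (a <ᵇ x) (F c a)))
                                      (sym (when-sum (a <ᵇ x) (λ c → when (c <ᵇ y) (F c a)))))))
    reindex : ∀ a → when (a <ᵇ x) (J y f (p ∘ swap a x)) ≡ when (a <ᵇ x) (sum (λ c → when (c <ᵇ y) (F c a)))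
    reindex a = when-cong (a <ᵇ x) λ a<x →
      let a<y = <⇒<ᵇ (ℕP.<-trans (<ᵇ⇒< a<x) (<ᵇ⇒< x<y))
          t = swap a x
          t-fixes-y : t y ≡ y
          t-fixes-y = swap-≢ (<ᵇ⇒≢ a<y ∘ sym) (<ᵇ⇒≢ x<y ∘ sym)
      in trans (sum-swap a x _)
               (sum-cong-≗ λ c → cong₂ when (<ᵇ-swap a x y c (trans a<y (sym x<y)))
                 (rf λ z → cong p (trans (swap-swap a x (t c) y z)
                                         (cong₂ (λ u v → swap u v (t z)) (swap-involutive a x c) t-fixes-y))))

  J^ : Fin n → ℕ → ℕ[𝔖] → ℕ[𝔖]
  J^ b zero f = f
  J^ b (suc r) f = J b (J^ b r f)

  hJ₂ : Fin n → Fin n → ℕ → ℕ[𝔖] → ℕ[𝔖]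
  hJ₂ x y zero f = f
  hJ₂ x y (suc r) f = J^ y (suc r) f ⊕ J x (hJ₂ x y r f)

  ∑-antidiagonal : ℕ → (ℕ → ℕ → ℕ[𝔖]) → ℕ[𝔖]
  ∑-antidiagonal zero F = F 0 0
  ∑-antidiagonal (suc m) F = F 0 (suc m) ⊕ ∑-antidiagonal m (F ∘ suc)

  J^-respects : ∀ b r {f} → Respects-≗ f → Respects-≗ (J^ b r f)
  J^-respects b zero rf = rf
  J^-respects b (suc r) rf = J-respects b (J^-respects b r rf)

  hJ₂-respects : ∀ x y r {f} → Respects-≗ f → Respects-≗ (hJ₂ x y r f)
  hJ₂-respects x y zero rf = rf
  hJ₂-respects x y (suc r) rf = ⊕-respects (J^-respects y (suc r) rf) (J-respects x (hJ₂-respects x y r rf))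

  J^-cong : ∀ b r {f g} → f ≗ g → J^ b r f ≗ J^ b r g
  J^-cong b zero f≗g = f≗g
  J^-cong b (suc r) f≗g = J-cong b (J^-cong b r f≗g)

  hJ₂-cong : ∀ x y r {f g} → f ≗ g → hJ₂ x y r f ≗ hJ₂ x y r g
  hJ₂-cong x y zero f≗g = f≗g
  hJ₂-cong x y (suc r) f≗g p = cong₂ _+_ (J^-cong y (suc r) f≗g p) (J-cong x (hJ₂-cong x y r f≗g) p)

  hJ₂-recurrence : ∀ x y r f → (J x (hJ₂ x y (suc r) f) ⊕ J y (hJ₂ x y (suc r) f)) ≗
                                (hJ₂ x y (suc (suc r)) f ⊕ J y (J x (hJ₂ x y r f)))
  hJ₂-recurrence x y r f p =
    trans (cong (J x (hJ₂ x y (suc r) f) p +_) (J-⊕ y (J^ y (suc r) f) (J x (hJ₂ x y r f)) p))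
          (x∙yz≈yx∙z (J x (hJ₂ x y (suc r) f) p) (J^ y (suc (suc r)) f p) (J y (J x (hJ₂ x y r f)) p))

  ∑-antidiagonal-⊕ : ∀ m (F G : ℕ → ℕ → ℕ[𝔖]) →
                     ∑-antidiagonal m (λ r k → F r k ⊕ G r k) ≗ (∑-antidiagonal m F ⊕ ∑-antidiagonal m G)
  ∑-antidiagonal-⊕ zero F G p = refl
  ∑-antidiagonal-⊕ (suc m) F G p =
    trans (cong (F 0 (suc m) p + G 0 (suc m) p +_) (∑-antidiagonal-⊕ m (F ∘ suc) (G ∘ suc) p))
          (interchange (F 0 (suc m) p) (G 0 (suc m) p) (∑-antidiagonal m (F ∘ suc) p) (∑-antidiagonal m (G ∘ suc) p))

  J-∑-antidiagonal : ∀ c m (F : ℕ → ℕ → ℕ[𝔖]) →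
                     J c (∑-antidiagonal m F) ≗ ∑-antidiagonal m (λ r k → J c (F r k))
  J-∑-antidiagonal c zero F p = refl
  J-∑-antidiagonal c (suc m) F p =
    trans (J-⊕ c (F 0 (suc m)) (∑-antidiagonal m (F ∘ suc)) p)
          (cong (J c (F 0 (suc m)) p +_) (J-∑-antidiagonal c m (F ∘ suc) p))

  hJ-cons : ∀ y L k → hJ (y ∷ L) k ≗ ∑-antidiagonal k (λ j k′ → J^ y j (hJ L k′))
  hJ-cons y L zero p = refl
  hJ-cons y L (suc k) p =
    cong (hJ L (suc k) p +_) (trans (J-cong y (hJ-cons y L k) p) (J-∑-antidiagonal y k (λ j k′ → J^ y j (hJ L k′)) p))

  hJ-cons₂ : ∀ x y L m → hJ (x ∷ y ∷ L) m ≗ ∑-antidiagonal m (λ r k → hJ₂ x y r (hJ L k))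
  hJ-cons₂ x y L zero p = refl
  hJ-cons₂ x y L (suc m) p = sym (begin
      hJ L (suc m) p + ∑-antidiagonal m (λ r k → J^ y (suc r) (hJ L k) ⊕ J x (hJ₂ x y r (hJ L k))) p
    ≡⟨ cong (hJ L (suc m) p +_) (∑-antidiagonal-⊕ m (λ r k → J^ y (suc r) (hJ L k))
                                                     (λ r k → J x (hJ₂ x y r (hJ L k))) p) ⟩
      hJ L (suc m) p + (∑-antidiagonal m (λ r k → J^ y (suc r) (hJ L k)) p
                        + ∑-antidiagonal m (λ r k → J x (hJ₂ x y r (hJ L k))) p)
    ≡⟨ sym (ℕP.+-assoc (hJ L (suc m) p) _ _) ⟩
      ∑-antidiagonal (suc m) (λ j k → J^ y j (hJ L k)) p + ∑-antidiagonal m (λ r k → J x (hJ₂ x y r (hJ L k))) p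
    ≡⟨ cong₂ _+_ (sym (hJ-cons y L (suc m) p)) (sym (J-∑-antidiagonal x m (λ r k → hJ₂ x y r (hJ L k)) p)) ⟩
      hJ (y ∷ L) (suc m) p + J x (∑-antidiagonal m (λ r k → hJ₂ x y r (hJ L k))) p
    ≡⟨ cong (hJ (y ∷ L) (suc m) p +_) (J-cong x (sym ∘ hJ-cons₂ x y L m) p) ⟩
      hJ (y ∷ L) (suc m) p + J x (hJ (x ∷ y ∷ L) m) p
    ∎)
    where open ≡-Reasoning

  postcompose-J^ : ∀ x y b r f → postcompose x y (J^ b r f) ≗ J^ b r (postcompose x y f)
  postcompose-J^ x y b zero f p = refl
  postcompose-J^ x y b (suc r) f p = J-cong b (postcompose-J^ x y b r f) p

  postcompose-hJ₂ : ∀ x y r f → postcompose x y (hJ₂ x y r f) ≗ hJ₂ x y r (postcompose x y f)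
  postcompose-hJ₂ x y zero f p = refl
  postcompose-hJ₂ x y (suc r) f p = cong₂ _+_ (postcompose-J^ x y y (suc r) f p) (J-cong x (postcompose-hJ₂ x y r f) p)

  module AdjacentTransposition (x y : Fin n) (y≡1+x : toℕ y ≡ suc (toℕ x)) where

    private
      pre = precompose x y

      x<y : x <ᵇ y ≡ true
      x<y = <⇒<ᵇ (ℕP.≤-reflexive (sym y≡1+x))

    precompose-e₁ : ∀ f → Respects-≗ f → pre (J x f ⊕ J y f) ≗ (J x (pre f) ⊕ J y (pre f))
    precompose-e₁ f rf p =
      trans (cong (pre (J x f) p +_) (precompose-J-upper x y y≡1+x f rf p))
      (trans (x∙yz≈yx∙z (pre (J x f) p) (J x (pre f) p) (f p))
      (trans (ℕP.+-assoc (J x (pre f) p) (pre (J x f) p) (f p))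
             (cong (J x (pre f) p +_) (precompose-J-lower x y y≡1+x f rf p))))

    precompose-e₂ : ∀ f → Respects-≗ f → pre (J y (J x f)) ≗ J y (J x (pre f))
    precompose-e₂ f rf p =
      trans (precompose-J-upper x y y≡1+x (J x f) (J-respects x rf) p)
      (trans (sym (J-⊕ x (pre (J x f)) f p))
      (trans (J-cong x (precompose-J-lower x y y≡1+x f rf) p)
             (J-comm x y (pre f) x<y (precompose-respects x y rf) p)))

    -- h_r(J_x, J_y) is a polynomial in e₁ = J_x + J_y and e₂ = J_x J_y, both of which commute with (x y).
    precompose-hJ₂ : ∀ r f → Respects-≗ f → pre (hJ₂ x y r f) ≗ hJ₂ x y r (pre f)
    precompose-hJ₂ r f rf = proj₁ (two-steps r)
      where
      Step : ℕ → Set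
      Step r = pre (hJ₂ x y r f) ≗ hJ₂ x y r (pre f)
      two-steps : ∀ r → Step r × Step (suc r)
      two-steps zero = (λ p → refl) , λ p →
        trans (ℕP.+-comm (pre (J y f) p) (pre (J x f) p))
              (trans (precompose-e₁ f rf p) (ℕP.+-comm (J x (pre f) p) (J y (pre f) p)))
      two-steps (suc r) = proj₂ ih , λ p →
        ℕP.+-cancelʳ-≡ _ (pre (hJ₂ x y (suc (suc r)) f) p) (hJ₂ x y (suc (suc r)) (pre f) p) (begin
            pre (hJ₂ x y (suc (suc r)) f) p + J y (J x (hJ₂ x y r (pre f))) p
          ≡⟨ cong (pre (hJ₂ x y (suc (suc r)) f) p +_)
                  (sym (trans (precompose-e₂ (hJ₂ x y r f) (hJ₂-respects x y r rf) p) (J-cong y (J-cong x (proj₁ ih)) p))) ⟩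
            pre (hJ₂ x y (suc (suc r)) f) p + pre (J y (J x (hJ₂ x y r f))) p
          ≡⟨ sym (hJ₂-recurrence x y r f (p ∘ swap x y)) ⟩
            pre (J x (hJ₂ x y (suc r) f) ⊕ J y (hJ₂ x y (suc r) f)) p
          ≡⟨ precompose-e₁ (hJ₂ x y (suc r) f) (hJ₂-respects x y (suc r) rf) p ⟩
            J x (pre (hJ₂ x y (suc r) f)) p + J y (pre (hJ₂ x y (suc r) f)) p
          ≡⟨ cong₂ _+_ (J-cong x (proj₂ ih) p) (J-cong y (proj₂ ih) p) ⟩
            J x (hJ₂ x y (suc r) (pre f)) p + J y (hJ₂ x y (suc r) (pre f)) p
          ≡⟨ hJ₂-recurrence x y r (pre f) p ⟩
            hJ₂ x y (suc (suc r)) (pre f) p + J y (J x (hJ₂ x y r (pre f))) p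
          ∎)
        where
        open ≡-Reasoning
        ih = two-steps r

    hJ₂-commutes : ∀ r f → Respects-≗ f → CommutesWith x y f → CommutesWith x y (hJ₂ x y r f)
    hJ₂-commutes r f rf cf p =
      trans (precompose-hJ₂ r f rf p) (trans (hJ₂-cong x y r cf p) (sym (postcompose-hJ₂ x y r f p)))

    ∑-antidiagonal-commutes : ∀ m (F : ℕ → ℕ → ℕ[𝔖]) → (∀ r k → CommutesWith x y (F r k)) →
                              CommutesWith x y (∑-antidiagonal m F)
    ∑-antidiagonal-commutes zero F cF = cF 0 0
    ∑-antidiagonal-commutes (suc m) F cF =
      ⊕-commutes x y (F 0 (suc m)) (∑-antidiagonal m (F ∘ suc))
                     (cF 0 (suc m)) (∑-antidiagonal-commutes m (F ∘ suc) (cF ∘ suc))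

    J-commutes : ∀ c f → Respects-≗ f → swap x y c ≡ c → x <ᵇ c ≡ y <ᵇ c →
                 CommutesWith x y f → CommutesWith x y (J c f)
    J-commutes c f rf sc≡c x~y cf p = trans (precompose-J x y c f rf sc≡c x~y p) (J-cong c cf p)

    data Compatible : List (Fin n) → Set where
      [] : Compatible []
      fixed : ∀ {c L} → swap x y c ≡ c → x <ᵇ c ≡ y <ᵇ c → Compatible L → Compatible (c ∷ L)
      pair : ∀ {L} → Compatible L → Compatible (x ∷ y ∷ L)

    hJ-commutes : ∀ {L} → Compatible L → ∀ m → CommutesWith x y (hJ L m)
    hJ-commutes _ zero = 𝟙-commutes x y
    hJ-commutes [] (suc m) p = refl
    hJ-commutes {c ∷ L} (fixed sc≡c x~y cL) (suc m) =
      ⊕-commutes x y (hJ L (suc m)) (J c (hJ (c ∷ L) m)) (hJ-commutes cL (suc m))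
                     (J-commutes c _ (hJ-respects (c ∷ L) m) sc≡c x~y (hJ-commutes (fixed sc≡c x~y cL) m))
    hJ-commutes {_ ∷ _ ∷ L} (pair cL) m =
      commutes-cong x y (sym ∘ hJ-cons₂ x y L m)
        (∑-antidiagonal-commutes m _ (λ r k → hJ₂-commutes r (hJ L k) (hJ-respects L k) (hJ-commutes cL k)))

-- Central elements are class functions

module ConjugationInvariance (n : ℕ) where

  open JucysMurphy n

  SwapInvariant : ℕ[𝔖] → Fin n → Fin n → Set
  SwapInvariant f i j = ∀ p → f (swap i j ∘ p ∘ swap i j) ≡ f p

  module _ (f : ℕ[𝔖]) (rf : Respects-≗ f)
           (commutes : ∀ x y → toℕ y ≡ suc (toℕ x) → CommutesWith x y f) where

    adjacent-invariant : ∀ x y → toℕ y ≡ suc (toℕ x) → SwapInvariant f x y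
    adjacent-invariant x y y≡1+x p = trans (commutes x y y≡1+x (swap x y ∘ p)) (rf (swap-involutive x y ∘ p))

    conjugate-invariant : ∀ {a b c d i j} → SwapInvariant f a b → SwapInvariant f c d →
                          swap i j ≗ swap a b ∘ swap c d ∘ swap a b → SwapInvariant f i j
    conjugate-invariant {a} {b} {c} {d} {i} {j} inv-ab inv-cd ij≗abcdab p =
      trans (rf (λ z → trans (ij≗abcdab (p (swap i j z))) (cong (s ∘ t ∘ s ∘ p) (ij≗abcdab z))))
      (trans (inv-ab (t ∘ s ∘ p ∘ s ∘ t))
      (trans (inv-cd (s ∘ p ∘ s)) (inv-ab p)))
      where
      s = swap a b
      t = swap c d

    distant-invariant : ∀ d i j → toℕ j ≡ toℕ i + suc d → SwapInvariant f i j
    distant-invariant zero i j j≡i+1 = adjacent-invariant i j (trans j≡i+1 (ℕP.+-comm (toℕ i) 1))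
    distant-invariant (suc d) i j j≡i+2+d =
      conjugate-invariant (adjacent-invariant j′ j j≡1+j′) (distant-invariant d i j′ (toℕ-fromℕ< j′<n)) via-j′
      where
      j′<n : toℕ i + suc d < n
      j′<n = ℕP.<-trans (ℕP.+-monoʳ-< (toℕ i) (ℕP.n<1+n (suc d))) (subst (_< n) j≡i+2+d (toℕ<n j))
      j′ = fromℕ< j′<n
      j≡1+j′ : toℕ j ≡ suc (toℕ j′)
      j≡1+j′ = trans j≡i+2+d (trans (ℕP.+-suc (toℕ i) (suc d)) (cong suc (sym (toℕ-fromℕ< j′<n))))
      i≢ : ∀ {w e} → toℕ w ≡ toℕ i + suc e → i ≢ w
      i≢ {e = e} w≡i+1+e refl = ℕP.m+1+n≢m (toℕ i) (sym w≡i+1+e)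
      via-j′ : swap i j ≗ swap j′ j ∘ swap i j′ ∘ swap j′ j
      via-j′ z = sym (trans (swap-swap j′ j i j′ (swap j′ j z))
        (trans (cong₂ (λ u v → swap u v (swap j′ j (swap j′ j z)))
                      (swap-≢ (i≢ (toℕ-fromℕ< j′<n)) (i≢ j≡i+2+d)) (swap-left j′ j))
               (cong (swap i j) (swap-involutive j′ j z))))

    swap-invariant : ∀ i j → SwapInvariant f i j
    swap-invariant i j with ℕP.<-cmp (toℕ i) (toℕ j)
    ... | tri< i<j _ _ = distant-invariant _ i j (sym (trans (ℕP.+-suc (toℕ i) _) (ℕP.m+[n∸m]≡n i<j)))
    ... | tri≈ _ i≡j _ rewrite toℕ-injective i≡j = λ p → rf (λ z → trans (swap-self j _) (cong p (swap-self j z)))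
    ... | tri> _ _ j<i = λ p →
      trans (rf (λ z → trans (swap-sym i j (p (swap i j z))) (cong (swap j i ∘ p) (swap-sym i j z))))
            (distant-invariant _ j i (sym (trans (ℕP.+-suc (toℕ j) _) (ℕP.m+[n∸m]≡n j<i))) p)

    eval-invariant : ∀ xs p → f ((eval xs ⟨$⟩ʳ_) ∘ p ∘ (eval xs ⟨$⟩ˡ_)) ≡ f p
    eval-invariant [] p = refl
    eval-invariant ((i , j) ∷ xs) p =
      trans (eval-invariant xs ((transpose i j ⟨$⟩ʳ_) ∘ p ∘ (transpose i j ⟨$⟩ˡ_)))
            (trans (rf (λ z → trans (transpose≗swap i j (p (transpose i j ⟨$⟩ˡ z)))
                                    (cong (swap i j ∘ p) (trans (transpose≗swap j i z) (swap-sym j i z)))))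
                   (swap-invariant i j p))

    permutation-invariant : ∀ (σ : Permutation′ n) p → f ((σ ⟨$⟩ʳ_) ∘ p ∘ (σ ⟨$⟩ˡ_)) ≡ f p
    permutation-invariant σ p =
      trans (rf (λ z → trans (sym (eval-decompose σ _)) (cong ((E ⟨$⟩ʳ_) ∘ p) (same-inverse z))))
            (eval-invariant (decompose σ) p)
      where
      E = eval (decompose σ)
      same-inverse : ∀ z → σ ⟨$⟩ˡ z ≡ E ⟨$⟩ˡ z
      same-inverse z = trans (sym (inverseˡ E)) (cong (E ⟨$⟩ˡ_) (trans (eval-decompose σ _) (inverseʳ σ)))

module Levels (n : ℕ) where

  open JucysMurphy n

  level : ∀ k {d} → k + suc d ≡ n → Fin n
  level k k+d≡n = fromℕ< (subst (k <_) k+d≡n (ℕP.m<m+n k z<s))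

  toℕ-level : ∀ k {d} (k+d≡n : k + suc d ≡ n) → toℕ (level k k+d≡n) ≡ k
  toℕ-level k k+d≡n = toℕ-fromℕ< _

  upFrom : (k d : ℕ) → k + d ≡ n → List (Fin n)
  upFrom k zero _ = []
  upFrom k (suc d) k+d≡n = level k k+d≡n ∷ upFrom (suc k) d (trans (sym (ℕP.+-suc k d)) k+d≡n)

  levels : List (Fin n)
  levels = upFrom 0 n refl

  module _ (x y : Fin n) (y≡1+x : toℕ y ≡ suc (toℕ x)) where

    open AdjacentTransposition x y y≡1+x

    compatible-upFrom : ∀ k d (k+d≡n : k + d ≡ n) → k ≢ toℕ y → Compatible (upFrom k d k+d≡n)
    compatible-upFrom k zero _ _ = []
    compatible-upFrom k (suc d) k+d≡n k≢y with k ℕ.≟ toℕ x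
    compatible-upFrom k (suc zero) k+1≡n k≢y | yes refl =
      ⊥-elim (ℕP.<-irrefl (trans y≡1+x (trans (ℕP.+-comm 1 k) k+1≡n)) (toℕ<n y))
    compatible-upFrom k (suc (suc d)) k+d≡n k≢y | yes refl =
      subst Compatible (cong₂ (λ u v → u ∷ v ∷ upFrom (suc (suc k)) d k+2+d≡n)
                              (toℕ-injective (sym (toℕ-level k k+d≡n)))
                              (toℕ-injective (trans y≡1+x (sym (toℕ-level (suc k) k+1+d≡n)))))
            (pair (compatible-upFrom (suc (suc k)) d k+2+d≡n (λ k+2≡y → ℕP.1+n≢n (trans k+2≡y y≡1+x))))
      where
      k+1+d≡n : suc k + suc d ≡ n
      k+1+d≡n = trans (sym (ℕP.+-suc k (suc d))) k+d≡n
      k+2+d≡n : suc (suc k) + d ≡ n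
      k+2+d≡n = trans (sym (ℕP.+-suc (suc k) d)) k+1+d≡n
    compatible-upFrom k (suc d) k+d≡n k≢y | no k≢x = fixed (swap-≢ (k≢x ∘ at-k) (k≢y ∘ at-k)) same-side
      (compatible-upFrom (suc k) d _ (λ 1+k≡y → k≢x (ℕP.suc-injective (trans 1+k≡y y≡1+x))))
      where
      b = level k k+d≡n
      at-k : ∀ {w} → b ≡ w → k ≡ toℕ w
      at-k refl = sym (toℕ-level k k+d≡n)
      same-side : x <ᵇ b ≡ y <ᵇ b
      same-side = true⇔true⇒≡
        (λ x<b → <⇒<ᵇ (ℕP.≤∧≢⇒< (subst (_≤ toℕ b) (sym y≡1+x) (<ᵇ⇒< x<b))
                                (λ y≡b → k≢y (trans (sym (toℕ-level k k+d≡n)) (sym y≡b)))))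
        (λ y<b → <⇒<ᵇ (ℕP.<-trans (subst (toℕ x <_) (sym y≡1+x) (ℕP.n<1+n _)) (<ᵇ⇒< y<b)))

    hJ-levels-commutes : ∀ m → CommutesWith x y (hJ levels m)
    hJ-levels-commutes = hJ-commutes (compatible-upFrom 0 n refl (λ 0≡y → ℕP.0≢1+n (trans 0≡y y≡1+x)))

  hJ-levels-invariant : ∀ m (σ : Permutation′ n) p → hJ levels m ((σ ⟨$⟩ʳ_) ∘ p ∘ (σ ⟨$⟩ˡ_)) ≡ hJ levels m p
  hJ-levels-invariant m =
    permutation-invariant (hJ levels m) (hJ-respects levels m) (λ x y y≡1+x → hJ-levels-commutes x y y≡1+x m)
    where open ConjugationInvariance n

-- Monotone factorisations

module MonotoneFactorisations (n : ℕ) where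

  open JucysMurphy n
  open Levels n

  lower upper : Transposition n → Fin n
  lower t = proj₁ (proj₁ t)
  upper t = proj₂ (proj₁ t)

  productIs′ : ∀ {m} → Vec (Transposition n) m → (Fin n → Fin n) → Bool
  productIs′ ts π = allF (λ x → applyProduct ts x == π x)

  -- Only the first level is tested; for monotone words it bounds all of them.
  upper≥ : ∀ {m} → ℕ → Vec (Transposition n) m → Bool
  upper≥ k [] = true
  upper≥ k (t ∷ _) = ⌊ k ℕ.≤? toℕ (upper t) ⌋

  IsFactorisation : ℕ → (Fin n → Fin n) → ∀ {m} → Vec (Transposition n) m → Bool
  IsFactorisation k π ts = (productIs′ ts π ∧ monotone (toList ts)) ∧ upper≥ k ts

  Factorisations : ℕ → ℕ → (Fin n → Fin n) → Set
  Factorisations k m π = Σ (Vec (Transposition n) m) (T ∘ IsFactorisation k π)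

  productIs′-∷ : ∀ {m} t (ts : Vec (Transposition n) m) π →
                 productIs′ (t ∷ ts) π ≡ productIs′ ts (π ∘ swap (lower t) (upper t))
  productIs′-∷ t ts π = true⇔true⇒≡
    (λ tts≡π → allF-complete _ λ y → ≡⇒== (trans (cong (applyProduct ts) (sym (swap-involutive (lower t) (upper t) y)))
                                                  (==⇒≡ (allF-sound _ tts≡π (s y)))))
    (λ ts≡πs → allF-complete _ λ x → ≡⇒== (trans (==⇒≡ (allF-sound _ ts≡πs (s x)))
                                                  (cong π (swap-involutive (lower t) (upper t) x))))
    where
    s = swap (lower t) (upper t)

  monotone-tail : ∀ {m} t (ts : Vec (Transposition n) m) →
                  monotone (toList (t ∷ ts)) ≡ true → monotone (toList ts) ≡ true
  monotone-tail t [] _ = refl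
  monotone-tail t (s ∷ ts) mono = proj₂ (∧-elim {⌊ toℕ (upper t) ℕ.≤? toℕ (upper s) ⌋} mono)

  monotone-∷ : ∀ {m} t (ts : Vec (Transposition n) m) → upper≥ (toℕ (upper t)) ts ≡ true →
               monotone (toList ts) ≡ true → monotone (toList (t ∷ ts)) ≡ true
  monotone-∷ t [] _ _ = refl
  monotone-∷ t (s ∷ ts) t≤s mono = ∧-intro t≤s mono

  monotone⇒upper≥ : ∀ {m} t (ts : Vec (Transposition n) m) → monotone (toList (t ∷ ts)) ≡ true →
                    upper≥ (toℕ (upper t)) ts ≡ true
  monotone⇒upper≥ t [] _ = refl
  monotone⇒upper≥ t (s ∷ ts) mono = proj₁ (∧-elim {⌊ toℕ (upper t) ℕ.≤? toℕ (upper s) ⌋} mono)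

  upper≥-weaken : ∀ {m} k k′ (ts : Vec (Transposition n) m) → k′ ≤ k →
                  upper≥ k ts ≡ true → upper≥ k′ ts ≡ true
  upper≥-weaken k k′ [] _ _ = refl
  upper≥-weaken k k′ (t ∷ ts) k′≤k k≤t =
    ⌊⌋-true (k′ ℕ.≤? _) (ℕP.≤-trans k′≤k (⌊⌋-sound (k ℕ.≤? _) k≤t))

  module Parts {k π m} {ts : Vec (Transposition n) m} (isF : T (IsFactorisation k π ts)) where

    product : productIs′ ts π ≡ true
    product = proj₁ (∧-elim (proj₁ (∧-elim (T→≡ isF))))

    mono : monotone (toList ts) ≡ true
    mono = proj₂ (∧-elim {productIs′ ts π} (proj₁ (∧-elim (T→≡ isF))))

    bounded : upper≥ k ts ≡ true
    bounded = proj₂ (∧-elim {productIs′ ts π ∧ monotone (toList ts)} (T→≡ isF))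

  isFactorisation : ∀ {m} k π (ts : Vec (Transposition n) m) →
                    productIs′ ts π ≡ true → monotone (toList ts) ≡ true → upper≥ k ts ≡ true →
                    T (IsFactorisation k π ts)
  isFactorisation k π ts prod mono up = ≡→T (∧-intro (∧-intro prod mono) up)

  -- The recurrence h_{m+1}(J_b, J_L) = h_{m+1}(J_L) + J_b h_m(J_b, J_L), read on factorisations:
  -- either no level equals k = b, or the first factor is some (a b).
  module SplitFirstLevel (k m : ℕ) (π : Fin n → Fin n) (b : Fin n) (b≡k : toℕ b ≡ k) where

    Cases : Set
    Cases = Factorisations (suc k) (suc m) π ⊎ Σ (Fin n) (λ a → T (a <ᵇ b) × Factorisations k m (π ∘ swap a b))

    to : Factorisations k (suc m) π → Cases
    to (t ∷ ts , isF) with toℕ (upper t) ℕ.≟ k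
    ... | yes t≡k = inj₂ (lower t , subst (T ∘ (lower t <ᵇ_)) t≡b (proj₂ t) , ts ,
                          isFactorisation k (π ∘ swap (lower t) b) ts product′ (monotone-tail t ts F.mono) bounded′)
      where
      module F = Parts {k} {π} {ts = t ∷ ts} isF
      t≡b : upper t ≡ b
      t≡b = toℕ-injective (trans t≡k (sym b≡k))
      product′ : productIs′ ts (π ∘ swap (lower t) b) ≡ true
      product′ = subst (λ c → productIs′ ts (π ∘ swap (lower t) c) ≡ true) t≡b
                       (trans (sym (productIs′-∷ t ts π)) F.product)
      bounded′ : upper≥ k ts ≡ true
      bounded′ = subst (λ j → upper≥ j ts ≡ true) t≡k (monotone⇒upper≥ t ts F.mono)
    ... | no t≢k = inj₁ (t ∷ ts , isFactorisation (suc k) π (t ∷ ts) F.product F.mono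
                          (⌊⌋-true (suc k ℕ.≤? _) (ℕP.≤∧≢⇒< (⌊⌋-sound (k ℕ.≤? _) F.bounded) (t≢k ∘ sym))))
      where
      module F = Parts {k} {π} {ts = t ∷ ts} isF

    from : Cases → Factorisations k (suc m) π
    from (inj₁ (ts , isF)) = ts , isFactorisation k π ts F.product F.mono (upper≥-weaken (suc k) k ts (ℕP.n≤1+n k) F.bounded)
      where
      module F = Parts {suc k} {π} {ts = ts} isF
    from (inj₂ (a , a<b , ts , isF)) = t ∷ ts ,
      isFactorisation k π (t ∷ ts) (trans (productIs′-∷ t ts π) F.product)
                      (monotone-∷ t ts (subst (λ j → upper≥ j ts ≡ true) (sym b≡k) F.bounded) F.mono)
                      (⌊⌋-true (k ℕ.≤? _) (ℕP.≤-reflexive (sym b≡k)))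
      where
      module F = Parts {k} {π ∘ swap a b} {ts = ts} isF
      t : Transposition n
      t = (a , b) , a<b

    from∘to : ∀ w → from (to w) ≡ w
    from∘to (t ∷ ts , _) with toℕ (upper t) ℕ.≟ k
    ... | yes t≡k = Σ-T-≡ (cong (_∷ ts) (Σ-T-≡ (cong (lower t ,_) (sym (toℕ-injective (trans t≡k (sym b≡k)))))))
    ... | no _ = Σ-T-≡ refl

    to∘from : ∀ c → to (from c) ≡ c
    to∘from (inj₁ (t ∷ ts , isF)) with toℕ (upper t) ℕ.≟ k
    ... | yes t≡k =
      ⊥-elim (ℕP.<-irrefl (sym t≡k) (⌊⌋-sound (suc k ℕ.≤? _) (Parts.bounded {suc k} {π} {ts = t ∷ ts} isF)))
    ... | no _ = cong inj₁ (Σ-T-≡ refl)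
    to∘from (inj₂ (a , a<b , ts , isF)) with toℕ b ℕ.≟ k
    ... | yes _ = cong inj₂ (cong₂ (λ u v → a , u , v) (T-irrelevant _ _) (Σ-T-≡ refl))
    ... | no b≢k = ⊥-elim (b≢k b≡k)

    split : Factorisations k (suc m) π ↔ Cases
    split = mk↔ₛ′ to from to∘from from∘to

  Factorisations-zero : ∀ k π → Factorisations k 0 π ↔ Fin (𝟙 π)
  Factorisations-zero k π =
    ↔-trans empty-word (↔-trans (subst (λ c → T (IsFactorisation k π []) ↔ T c) π≡id ↔-refl) (T↔Fin _))
    where
    empty-word : Factorisations k 0 π ↔ T (IsFactorisation k π [])
    empty-word = mk↔ₛ′ (λ { ([] , isF) → isF }) ([] ,_) (λ _ → refl) (λ { ([] , _) → refl })
    π≡id : IsFactorisation k π [] ≡ allF (λ z → π z == z)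
    π≡id = trans (∧-identityʳ _) (trans (∧-identityʳ _) (all-cong (allFin n) (λ x → ==-sym x (π x))))

  Factorisations-beyond : ∀ {k m} π → k ≡ n → Factorisations k (suc m) π ↔ Fin 0
  Factorisations-beyond {k} π k≡n = mk↔ₛ′ (⊥-elim ∘ impossible) (λ ()) (λ ()) (⊥-elim ∘ impossible)
    where
    impossible : Factorisations k _ π → ⊥
    impossible (t ∷ ts , isF) =
      ℕP.<-irrefl refl (ℕP.≤-<-trans (⌊⌋-sound (k ℕ.≤? _) (Parts.bounded {k} {π} {ts = t ∷ ts} isF))
                                      (subst (toℕ (upper t) <_) (sym k≡n) (toℕ<n (upper t))))

  Factorisations↔hJ : ∀ m k d (k+d≡n : k + d ≡ n) π → Factorisations k m π ↔ Fin (hJ (upFrom k d k+d≡n) m π)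
  Factorisations↔hJ zero k d k+d≡n π = Factorisations-zero k π
  Factorisations↔hJ (suc m) k zero k+0≡n π = Factorisations-beyond π (trans (sym (ℕP.+-identityʳ k)) k+0≡n)
  Factorisations↔hJ (suc m) k (suc d) k+d≡n π =
    ↔-trans (SplitFirstLevel.split k m π (level k k+d≡n) (toℕ-level k k+d≡n))
    (↔-trans (Factorisations↔hJ (suc m) (suc k) d _ π
                ⊎-↔ Σ-↔ ↔-refl (↔-refl ×-↔ Factorisations↔hJ m k (suc d) k+d≡n _))
    (↔-trans (↔-refl ⊎-↔ Σ-↔ ↔-refl (↔-sym (Fin-when _ _)))
    (↔-trans (↔-refl ⊎-↔ ↔-sym (Fin-sum _)) (↔-sym +↔⊎))))

  upper≥-zero : ∀ {m} (ts : Vec (Transposition n) m) → upper≥ 0 ts ≡ true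
  upper≥-zero [] = refl
  upper≥-zero (t ∷ _) = ⌊⌋-true (0 ℕ.≤? toℕ (upper t)) z≤n

  M↔hJ : ∀ g (ω : Permutation′ n) → M g ω ↔ Fin (hJ levels (numFactors ω g) (ω ⟨$⟩ʳ_))
  M↔hJ g ω = ↔-trans (Σ-T-cong λ ts → sym (trans (cong ((productIs ts ω ∧ monotone (toList ts)) ∧_) (upper≥-zero ts))
                                                  (∧-identityʳ _)))
                     (Factorisations↔hJ (numFactors ω g) 0 n refl (ω ⟨$⟩ʳ_))

-- Orbits of a permutation

search : (ℕ → Bool) → ℕ → ℕ → ℕ
search P k zero = k
search P k (suc f) = if P k then k else search P (suc k) f

record IsLeastFrom (P : ℕ → Bool) (k w s : ℕ) : Set where
  field
    holds : P s ≡ true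
    from : k ≤ s
    ≤-witness : s ≤ w
    least : ∀ q → k ≤ q → q < s → P q ≡ false

search-least : ∀ P k f w → k ≤ w → w < k + f → P w ≡ true → IsLeastFrom P k w (search P k f)
search-least P k zero w k≤w w<k+0 _ =
  ⊥-elim (ℕP.<-irrefl refl (ℕP.≤-<-trans k≤w (subst (w <_) (ℕP.+-identityʳ k) w<k+0)))
search-least P k (suc f) w k≤w w<k+f Pw with P k in Pk
... | true = record
  { holds = Pk ; from = ℕP.≤-refl ; ≤-witness = k≤w
  ; least = λ q k≤q q<k → ⊥-elim (ℕP.<-irrefl refl (ℕP.≤-<-trans k≤q q<k)) }
... | false = record
  { holds = IH.holds ; from = ℕP.≤-trans (ℕP.n≤1+n k) IH.from ; ≤-witness = IH.≤-witness ; least = least }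
  where
  k≢w : k ≢ w
  k≢w refl with trans (sym Pk) Pw
  ... | ()
  module IH = IsLeastFrom (search-least P (suc k) f w (ℕP.≤∧≢⇒< k≤w k≢w) (subst (w <_) (ℕP.+-suc k f) w<k+f) Pw)
  least : ∀ q → k ≤ q → q < search P (suc k) f → P q ≡ false
  least q k≤q q<s with k ℕ.≟ q
  ... | yes refl = Pk
  ... | no k≢q = IH.least q (ℕP.≤∧≢⇒< k≤q k≢q) q<s

firstFin : ∀ {n} → (Fin n → Bool) → Maybe (Fin n)
firstFin {zero} P = nothing
firstFin {suc n} P = if P fzero then just fzero else Maybe.map fsuc (firstFin (P ∘ fsuc))

firstFin-cong : ∀ {n} {P Q : Fin n → Bool} → (∀ x → P x ≡ Q x) → firstFin P ≡ firstFin Q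
firstFin-cong {zero} _ = refl
firstFin-cong {suc n} {P} {Q} P≗Q rewrite P≗Q fzero =
  cong (λ r → if Q fzero then just fzero else Maybe.map fsuc r) (firstFin-cong (P≗Q ∘ fsuc))

firstFin-least : ∀ {n} (P : Fin n → Bool) (j : Fin n) → P j ≡ true →
                 Σ (Fin n) (λ r → firstFin P ≡ just r × P r ≡ true × toℕ r ≤ toℕ j)
firstFin-least {suc n} P j Pj with P fzero in P0
... | true = fzero , refl , P0 , z≤n
firstFin-least {suc n} P fzero Pj | false with trans (sym P0) Pj
... | ()
firstFin-least {suc n} P (fsuc j) Pj | false with firstFin-least (P ∘ fsuc) j Pj
... | r , first≡r , Pr , r≤j = fsuc r , cong (Maybe.map fsuc) first≡r , Pr , s≤s r≤j

module Orbits {n : ℕ} (ω : Permutation′ n) where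

  iter-+ : ∀ s t i → iter ω (s + t) i ≡ iter ω s (iter ω t i)
  iter-+ zero t i = refl
  iter-+ (suc s) t i = cong (ω ⟨$⟩ʳ_) (iter-+ s t i)

  iter-injective : ∀ t {i j} → iter ω t i ≡ iter ω t j → i ≡ j
  iter-injective zero e = e
  iter-injective (suc t) e = iter-injective t (trans (sym (inverseˡ ω)) (trans (cong (ω ⟨$⟩ˡ_) e) (inverseˡ ω)))

  iter-comm : ∀ s t i → iter ω s (iter ω t i) ≡ iter ω t (iter ω s i)
  iter-comm s t i = trans (sym (iter-+ s t i)) (trans (cong (λ u → iter ω u i) (ℕP.+-comm s t)) (iter-+ t s i))

  fixed-along-orbit : ∀ d a i → iter ω d (iter ω a i) ≡ iter ω a i → iter ω d i ≡ i
  fixed-along-orbit d a i e = iter-injective a (trans (sym (iter-comm d a i)) e)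

  returns : ∀ i → Σ ℕ (λ d → 1 ≤ d × d ≤ n × iter ω d i ≡ i)
  returns i with pigeonhole (ℕP.n<1+n n) (λ (t : Fin (suc n)) → iter ω (toℕ t) i)
  ... | t₁ , t₂ , t₁<t₂ , e = toℕ t₂ ∸ toℕ t₁ , ℕP.m<n⇒0<n∸m t₁<t₂ ,
        ℕP.≤-trans (ℕP.m∸n≤m (toℕ t₂) (toℕ t₁)) (ℕP.≤-pred (toℕ<n t₂)) ,
        fixed-along-orbit (toℕ t₂ ∸ toℕ t₁) (toℕ t₁) i
          (trans (sym (iter-+ (toℕ t₂ ∸ toℕ t₁) (toℕ t₁) i))
                 (trans (cong (λ u → iter ω u i) (ℕP.m∸n+n≡m (ℕP.<⇒≤ t₁<t₂))) (sym e)))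

  returnsAt : Fin n → ℕ → Bool
  returnsAt i d = iter ω d i == i

  period : Fin n → ℕ
  period i = search (returnsAt i) 1 n

  private
    module Period (i : Fin n) = IsLeastFrom
      (search-least (returnsAt i) 1 n (proj₁ (returns i)) (proj₁ (proj₂ (returns i)))
                    (s≤s (proj₁ (proj₂ (proj₂ (returns i))))) (≡⇒== (proj₂ (proj₂ (proj₂ (returns i))))))

  iter-period : ∀ i → iter ω (period i) i ≡ i
  iter-period i = ==⇒≡ (Period.holds i)

  period-positive : ∀ i → 1 ≤ period i
  period-positive i = Period.from i

  period-≤ : ∀ i → period i ≤ n
  period-≤ i = ℕP.≤-trans (Period.≤-witness i) (proj₁ (proj₂ (proj₂ (returns i))))

  private
    ordered-injective : ∀ i a b → a ≤ b → b < period i → iter ω a i ≡ iter ω b i → a ≡ b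
    ordered-injective i a b a≤b b<p e with b ∸ a in b∸a≡d
    ... | zero = ℕP.≤-antisym a≤b (ℕP.m∸n≡0⇒m≤n b∸a≡d)
    ... | suc d with trans (sym (≡⇒== returns-after-d)) (Period.least i (suc d) (s≤s z≤n) d<p)
      where
      returns-after-d : iter ω (suc d) i ≡ i
      returns-after-d = fixed-along-orbit (suc d) a i
        (trans (sym (iter-+ (suc d) a i))
               (trans (cong (λ u → iter ω u i) (trans (cong (_+ a) (sym b∸a≡d)) (ℕP.m∸n+n≡m a≤b))) (sym e)))
      d<p : suc d < period i
      d<p = ℕP.≤-<-trans (subst (_≤ b) b∸a≡d (ℕP.m∸n≤m b a)) b<p
    ...   | ()

  iter-injective-below-period : ∀ i {a b} → a < period i → b < period i → iter ω a i ≡ iter ω b i → a ≡ b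
  iter-injective-below-period i {a} {b} a<p b<p e with ℕP.≤-total a b
  ... | inj₁ a≤b = ordered-injective i a b a≤b b<p e
  ... | inj₂ b≤a = sym (ordered-injective i b a b≤a a<p (sym e))

  iter-multiple-of-period : ∀ i q → iter ω (q * period i) i ≡ i
  iter-multiple-of-period i zero = refl
  iter-multiple-of-period i (suc q) =
    trans (iter-+ (period i) (q * period i) i) (trans (cong (iter ω (period i)) (iter-multiple-of-period i q)) (iter-period i))

  reduce-mod-period : ∀ i t → Σ ℕ (λ r → r < period i × iter ω t i ≡ iter ω r i)
  reduce-mod-period i t = t % p , m%n<n t p ,
    trans (cong (λ u → iter ω u i) (m≡m%n+[m/n]*n t p))
          (trans (iter-+ (t % p) ((t / p) * p) i) (cong (iter ω (t % p)) (iter-multiple-of-period i (t / p))))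
    where
    p = period i
    instance
      p≢0 : ℕ.NonZero p
      p≢0 = ℕ.>-nonZero (period-positive i)

  Reach : Fin n → Fin n → Set
  Reach i j = Σ ℕ (λ t → iter ω t i ≡ j)

  reach-refl : ∀ i → Reach i i
  reach-refl i = 0 , refl

  reach-trans : ∀ {i j k} → Reach i j → Reach j k → Reach i k
  reach-trans {i} (s , i→j) (t , j→k) = t + s , trans (iter-+ t s i) (trans (cong (iter ω t) i→j) j→k)

  reach-sym : ∀ {i j} → Reach i j → Reach j i
  reach-sym {i} (t , i→j) with reduce-mod-period i t
  ... | r , r<p , t~r = period i ∸ r ,
    trans (cong (iter ω (period i ∸ r)) (trans (sym i→j) t~r))
          (trans (sym (iter-+ (period i ∸ r) r i))
                 (trans (cong (λ u → iter ω u i) (ℕP.m∸n+n≡m (ℕP.<⇒≤ r<p))) (iter-period i)))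

  reach-step : ∀ i → Reach i (ω ⟨$⟩ʳ i)
  reach-step i = 1 , refl

  inCycle⇒reach : ∀ {i j} → inCycle ω i j ≡ true → Reach i j
  inCycle⇒reach {i} {j} i~j with any-sound (λ t → iter ω t i == j) (upTo n) i~j
  ... | t , iter≡j = t , ==⇒≡ iter≡j

  reach⇒inCycle : ∀ {i j} → Reach i j → inCycle ω i j ≡ true
  reach⇒inCycle {i} {j} (t , i→j) with reduce-mod-period i t
  ... | r , r<p , t~r = any-complete (λ t → iter ω t i == j) (upTo n) (∈-upTo⁺ (ℕP.<-≤-trans r<p (period-≤ i)))
                                     (≡⇒== (trans (sym t~r) i→j))

  inCycle-cong : ∀ {i i′} → Reach i i′ → ∀ j → inCycle ω i j ≡ inCycle ω i′ j
  inCycle-cong i→i′ j = true⇔true⇒≡ (λ i~j → reach⇒inCycle (reach-trans (reach-sym i→i′) (inCycle⇒reach i~j)))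
                                    (λ i′~j → reach⇒inCycle (reach-trans i→i′ (inCycle⇒reach i′~j)))

  exponent : Fin n → Fin n → ℕ
  exponent i j = search (λ t → iter ω t i == j) 0 (period i)

  exponent-spec : ∀ {i j} → Reach i j → iter ω (exponent i j) i ≡ j × exponent i j < period i
  exponent-spec {i} {j} (t , i→j) with reduce-mod-period i t
  ... | r , r<p , t~r = ==⇒≡ Exp.holds , ℕP.≤-<-trans Exp.≤-witness r<p
    where
    module Exp = IsLeastFrom (search-least (λ t → iter ω t i == j) 0 (period i) r z≤n r<p (≡⇒== (trans (sym t~r) i→j)))

  exponent-iter : ∀ i t → t < period i → exponent i (iter ω t i) ≡ t
  exponent-iter i t t<p = iter-injective-below-period i (proj₂ spec) t<p (proj₁ spec)
    where
    spec = exponent-spec (t , refl)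

  orbit↔period : ∀ i → Σ (Fin n) (T ∘ inCycle ω i) ↔ Fin (period i)
  orbit↔period i = mk↔ₛ′ to from to∘from from∘to
    where
    exponent<period : ∀ j → T (inCycle ω i j) → exponent i j < period i
    exponent<period j i~j = proj₂ (exponent-spec (inCycle⇒reach (T→≡ i~j)))
    to : Σ (Fin n) (T ∘ inCycle ω i) → Fin (period i)
    to (j , i~j) = fromℕ< (exponent<period j i~j)
    from : Fin (period i) → Σ (Fin n) (T ∘ inCycle ω i)
    from t = iter ω (toℕ t) i , ≡→T (reach⇒inCycle (toℕ t , refl))
    to∘from : ∀ t → to (from t) ≡ t
    to∘from t = toℕ-injective (trans (toℕ-fromℕ< _) (exponent-iter i (toℕ t) (toℕ<n t)))
    from∘to : ∀ j → from (to j) ≡ j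
    from∘to (j , i~j) = Σ-T-≡ (trans (cong (λ u → iter ω u i) (toℕ-fromℕ< (exponent<period j i~j)))
                                     (proj₁ (exponent-spec (inCycle⇒reach (T→≡ i~j)))))

  cycleLength≡period : ∀ i → cycleLength ω i ≡ period i
  cycleLength≡period i = Fin-↔-injective (↔-trans (↔-sym (count↔ (inCycle ω i))) (orbit↔period i))

  cycleMin : Fin n → Fin n
  cycleMin i = fromMaybe i (firstFin (inCycle ω i))

  private
    firstFin-orbit : ∀ i → Σ (Fin n) _
    firstFin-orbit i = firstFin-least (inCycle ω i) i (reach⇒inCycle (reach-refl i))

    cycleMin-first : ∀ i r → firstFin (inCycle ω i) ≡ just r → cycleMin i ≡ r
    cycleMin-first i r first≡r rewrite first≡r = refl

  reach-cycleMin : ∀ i → Reach i (cycleMin i)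
  reach-cycleMin i with firstFin-orbit i
  ... | r , first≡r , i~r , _ = subst (Reach i) (sym (cycleMin-first i r first≡r)) (inCycle⇒reach i~r)

  cycleMin-≤ : ∀ i j → Reach i j → toℕ (cycleMin i) ≤ toℕ j
  cycleMin-≤ i j i→j with firstFin-orbit i | firstFin-least (inCycle ω i) j (reach⇒inCycle i→j)
  ... | r , first≡r , _ | r′ , first≡r′ , _ , r′≤j =
    subst (λ u → toℕ u ≤ toℕ j)
          (sym (trans (cycleMin-first i r first≡r) (just-injective (trans (sym first≡r) first≡r′)))) r′≤j

  cycleMin-cong : ∀ {i i′} → Reach i i′ → cycleMin i ≡ cycleMin i′
  cycleMin-cong {i} {i′} i→i′ with firstFin-orbit i
  ... | r , first≡r , _ , _ =
    trans (cycleMin-first i r first≡r) (sym (cycleMin-first i′ r (trans (sym (firstFin-cong (inCycle-cong i→i′))) first≡r)))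

  isCycleMin-cycleMin : ∀ i → isCycleMin ω (cycleMin i) ≡ true
  isCycleMin-cycleMin i = allF-complete _ λ j → minimal j (inCycle ω (cycleMin i) j) refl
    where
    minimal : ∀ j b → inCycle ω (cycleMin i) j ≡ b → not b ∨ ⌊ toℕ (cycleMin i) ℕ.≤? toℕ j ⌋ ≡ true
    minimal j false _ = refl
    minimal j true m~j =
      ⌊⌋-true (toℕ (cycleMin i) ℕ.≤? toℕ j) (cycleMin-≤ i j (reach-trans (reach-cycleMin i) (inCycle⇒reach m~j)))

  isCycleMin⇒cycleMin≡ : ∀ i → isCycleMin ω i ≡ true → cycleMin i ≡ i
  isCycleMin⇒cycleMin≡ i min = toℕ-injective (ℕP.≤-antisym (cycleMin-≤ i i (reach-refl i)) i≤m)
    where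
    i≤m : toℕ i ≤ toℕ (cycleMin i)
    i≤m = ⌊⌋-sound (toℕ i ℕ.≤? toℕ (cycleMin i))
            (trans (cong (λ b → not b ∨ ⌊ toℕ i ℕ.≤? toℕ (cycleMin i) ⌋) (sym (reach⇒inCycle (reach-cycleMin i))))
                   (allF-sound _ min (cycleMin i)))

-- Permutations of equal cycle type are conjugate

module _ {n : ℕ} where

  IsCycleMinOfLength : Permutation′ n → ℕ → Fin n → Bool
  IsCycleMinOfLength π k i = isCycleMin π i ∧ ⌊ cycleLength π i ℕ.≟ k ⌋

  CycleMinsOfLength : Permutation′ n → ℕ → Set
  CycleMinsOfLength π k = Σ (Fin n) (T ∘ IsCycleMinOfLength π k)

  isCycleMinOfOwnLength : ∀ π i → T (isCycleMin π i) → T (IsCycleMinOfLength π (cycleLength π i) i)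
  isCycleMinOfOwnLength π i min = ≡→T (∧-intro (T→≡ min) (⌊⌋-true (cycleLength π i ℕ.≟ cycleLength π i) refl))

  -- σ sends ωᵗ i, for i a cycle minimum of ω, to γᵗ (μ i); μ matches cycle minima of equal cycle length.
  module CycleMatching (ω γ : Permutation′ n) (Φ : ∀ k → CycleMinsOfLength ω k ↔ CycleMinsOfLength γ k) where

    module ω = Orbits ω
    module γ = Orbits γ

    μ : ∀ i → T (isCycleMin ω i) → Fin n
    μ i min = proj₁ (Inverse.to (Φ (cycleLength ω i)) (i , isCycleMinOfOwnLength ω i min))

    ν : ∀ j → T (isCycleMin γ j) → Fin n
    ν j min = proj₁ (Inverse.from (Φ (cycleLength γ j)) (j , isCycleMinOfOwnLength γ j min))

    private
      μ-matched : ∀ i min → T (IsCycleMinOfLength γ (cycleLength ω i) (μ i min))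
      μ-matched i min = proj₂ (Inverse.to (Φ (cycleLength ω i)) (i , isCycleMinOfOwnLength ω i min))

    μ-isCycleMin : ∀ i min → isCycleMin γ (μ i min) ≡ true
    μ-isCycleMin i min = proj₁ (∧-elim (T→≡ (μ-matched i min)))

    μ-cycleLength : ∀ i min → cycleLength γ (μ i min) ≡ cycleLength ω i
    μ-cycleLength i min = ⌊⌋-sound (cycleLength γ (μ i min) ℕ.≟ cycleLength ω i)
                                   (proj₂ (∧-elim {isCycleMin γ (μ i min)} (T→≡ (μ-matched i min))))

    ν-μ : ∀ i min min′ → ν (μ i min) min′ ≡ i
    ν-μ i min min′ = trans (from-at (μ-cycleLength i min) _ (μ-matched i min))
                           (cong proj₁ (Inverse.strictlyInverseʳ (Φ (cycleLength ω i)) (i , isCycleMinOfOwnLength ω i min)))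
      where
      from-at : ∀ {k k′} → k ≡ k′ → ∀ p p′ →
                proj₁ (Inverse.from (Φ k) (μ i min , p)) ≡ proj₁ (Inverse.from (Φ k′) (μ i min , p′))
      from-at refl p p′ = cong (λ q → proj₁ (Inverse.from (Φ _) (μ i min , q))) (T-irrelevant p p′)

    μ-cong : ∀ {i i′} → i ≡ i′ → ∀ min min′ → μ i min ≡ μ i′ min′
    μ-cong {i} refl min min′ = cong (μ i) (T-irrelevant min min′)

    ν-cong : ∀ {j j′} → j ≡ j′ → ∀ min min′ → ν j min ≡ ν j′ min′
    ν-cong {j} refl min min′ = cong (ν j) (T-irrelevant min min′)

    σ : Fin n → Fin n
    σ z = iter γ (ω.exponent (ω.cycleMin z) z) (μ (ω.cycleMin z) (≡→T (ω.isCycleMin-cycleMin z)))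

    τ : Fin n → Fin n
    τ w = iter ω (γ.exponent (γ.cycleMin w) w) (ν (γ.cycleMin w) (≡→T (γ.isCycleMin-cycleMin w)))

    private
      module Coordinates (z : Fin n) where
        r = ω.cycleMin z
        r-min = ≡→T (ω.isCycleMin-cycleMin z)
        t = ω.exponent r z
        j = μ r r-min
        r→z = ω.exponent-spec (ω.reach-sym (ω.reach-cycleMin z))
        r↦z : iter ω t r ≡ z
        r↦z = proj₁ r→z
        t<period : t < ω.period r
        t<period = proj₂ r→z
        same-period : γ.period j ≡ ω.period r
        same-period = trans (sym (γ.cycleLength≡period j)) (trans (μ-cycleLength r r-min) (ω.cycleLength≡period r))

    σ-step : ∀ z → σ (ω ⟨$⟩ʳ z) ≡ γ ⟨$⟩ʳ σ z
    σ-step z = trans (cong₂ (λ u v → iter γ (ω.exponent u (ω ⟨$⟩ʳ z)) v) r≡ (μ-cong r≡ _ _)) next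
      where
      open Coordinates z
      r≡ : ω.cycleMin (ω ⟨$⟩ʳ z) ≡ r
      r≡ = sym (ω.cycleMin-cong (ω.reach-step z))
      next : iter γ (ω.exponent r (ω ⟨$⟩ʳ z)) j ≡ γ ⟨$⟩ʳ iter γ t j
      next with suc t ℕ.<? ω.period r
      ... | yes 1+t<p =
        cong (λ u → iter γ u j) (trans (cong (ω.exponent r ∘ (ω ⟨$⟩ʳ_)) (sym r↦z)) (ω.exponent-iter r (suc t) 1+t<p))
      ... | no 1+t≮p = trans (cong (λ u → iter γ u j) exponent≡0)
                             (trans (sym (γ.iter-period j)) (cong (λ u → iter γ u j) (trans same-period (sym 1+t≡p))))
        where
        1+t≡p : suc t ≡ ω.period r
        1+t≡p = ℕP.≤-antisym t<period (ℕP.≮⇒≥ 1+t≮p)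
        exponent≡0 : ω.exponent r (ω ⟨$⟩ʳ z) ≡ 0
        exponent≡0 = trans (cong (ω.exponent r)
                                 (trans (cong (ω ⟨$⟩ʳ_) (sym r↦z))
                                        (trans (cong (λ u → iter ω u r) 1+t≡p) (ω.iter-period r))))
                           (ω.exponent-iter r 0 (ω.period-positive r))

    τ-σ : ∀ z → τ (σ z) ≡ z
    τ-σ z = trans (cong₂ (λ u v → iter ω (γ.exponent u (σ z)) v) cycleMin-σ
                         (ν-cong cycleMin-σ _ (≡→T (μ-isCycleMin r r-min))))
                  (trans (cong₂ (iter ω) (γ.exponent-iter j t (subst (t <_) (sym same-period) t<period)) (ν-μ r r-min _)) r↦z)
      where
      open Coordinates z
      cycleMin-σ : γ.cycleMin (σ z) ≡ j
      cycleMin-σ = trans (sym (γ.cycleMin-cong (t , refl))) (γ.isCycleMin⇒cycleMin≡ j (μ-isCycleMin r r-min))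

  module SameCycleType (ω γ : Permutation′ n) (same : ∀ k → numCyclesOfLength ω k ≡ numCyclesOfLength γ k) where

    matching : ∀ k → CycleMinsOfLength ω k ↔ CycleMinsOfLength γ k
    matching k = ↔-trans (count↔ (IsCycleMinOfLength ω k))
                 (↔-trans (subst (λ c → Fin (numCyclesOfLength ω k) ↔ Fin c) (same k) ↔-refl)
                          (↔-sym (count↔ (IsCycleMinOfLength γ k))))

    module forward = CycleMatching ω γ matching
    module backward = CycleMatching γ ω (↔-sym ∘ matching)

    -- backward.σ is forward.τ and backward.τ is forward.σ, definitionally.
    conjugator : Permutation′ n
    conjugator = mk↔ₛ′ forward.σ forward.τ backward.τ-σ forward.τ-σ

    conjugates : ∀ z → γ ⟨$⟩ʳ z ≡ conjugator ⟨$⟩ʳ (ω ⟨$⟩ʳ (conjugator ⟨$⟩ˡ z))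
    conjugates z = trans (cong (γ ⟨$⟩ʳ_) (sym (backward.τ-σ z))) (sym (forward.σ-step (forward.τ z)))

    cycleMins↔ : Σ (Fin n) (T ∘ isCycleMin ω) ↔ Σ (Fin n) (T ∘ isCycleMin γ)
    cycleMins↔ = mk↔ₛ′ (λ (i , min) → forward.μ i min , ≡→T (forward.μ-isCycleMin i min))
                       (λ (j , min) → backward.μ j min , ≡→T (backward.μ-isCycleMin j min))
                       (λ (j , min) → Σ-T-≡ (backward.ν-μ j min _)) (λ (i , min) → Σ-T-≡ (forward.ν-μ i min _))

    numCycles≡ : numCycles ω ≡ numCycles γ
    numCycles≡ =
      Fin-↔-injective (↔-trans (↔-sym (count↔ (isCycleMin ω))) (↔-trans cycleMins↔ (count↔ (isCycleMin γ))))

corollary3p3 : (n : ℕ) (λ′ : List ℕ) → IsPartition n λ′ →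
    (ω γ : Permutation′ n) → HasCycleType ω λ′ → HasCycleType γ λ′ →
    (g : ℕ) → M g ω ⤖ M g γ
corollary3p3 n λ′ _ ω γ ω-type γ-type g =
  ↔⇒⤖ (↔-trans (M↔hJ g ω) (↔-trans (subst (λ c → Fin c ↔ Fin _) (sym same-count) ↔-refl) (↔-sym (M↔hJ g γ))))
  where
  open JucysMurphy n
  open Levels n
  open MonotoneFactorisations n
  open SameCycleType ω γ (λ k → trans (ω-type k) (sym (γ-type k)))
  open ≡-Reasoning
  same-count : hJ levels (numFactors ω g) (ω ⟨$⟩ʳ_) ≡ hJ levels (numFactors γ g) (γ ⟨$⟩ʳ_)
  same-count = begin
    hJ levels (numFactors ω g) (ω ⟨$⟩ʳ_)
      ≡⟨ cong (λ c → hJ levels (n ∸ c + 2 * g) (ω ⟨$⟩ʳ_)) numCycles≡ ⟩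
    hJ levels (numFactors γ g) (ω ⟨$⟩ʳ_)
      ≡⟨ hJ-levels-invariant (numFactors γ g) conjugator (ω ⟨$⟩ʳ_) ⟨
    hJ levels (numFactors γ g) ((conjugator ⟨$⟩ʳ_) ∘ (ω ⟨$⟩ʳ_) ∘ (conjugator ⟨$⟩ˡ_))
      ≡⟨ hJ-respects levels (numFactors γ g) (sym ∘ conjugates) ⟩
    hJ levels (numFactors γ g) (γ ⟨$⟩ʳ_)
      ∎
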